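{- Let $G$ be a graph of order $n\geq 3$, and let $u$ and $v$ be non-adjacent vertices of $G$. Then $$C(G+uv)\leq C(G)+\left(1-\frac{2}{n}+\frac{4}{n(n-1)}\right),$$ with equality if and only if $G$ is $K_{2,n-2}$ and $u$ and $v$ both have degree $n-2$ in $G$.
   Context: All graphs are finite and simple; $G+uv$ denotes the graph obtained from $G$ by adding the edge $uv$. For a vertex $u$ of a graph $G$ with neighborhood $N_G(u)$ and degree $d_G(u)$, the clustering coefficient of $u$ is $C_u(G)=m(G[N_G(u)])/\binom{d_G(u)}{2}$ if $d_G(u)\geq 2$, and $C_u(G)=0$ otherwise, where $m(G[N_G(u)])$ is the number of edges of the subgraph induced by $N_G(u)$. The clustering coefficient of $G$ is $C(G)=\frac{1}{n(G)}\sum_{u\in V(G)}C_u(G)$, where $n(G)$ is the order of $G$. -}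

module Defs where

open import Data.Bool using (Bool; true; false; if_then_else_; _∧_; _∨_; _xor_)
open import Data.Nat as ℕ using (ℕ; zero; suc; NonZero; _<ᵇ_)
open import Data.Nat.Properties using (+-comm)
open import Data.Nat.Combinatorics using (_C_; nC1≡n; nCk+nC[k+1]≡[n+1]C[k+1])
open import Data.Fin using (Fin; toℕ)
open import Data.Fin.Properties using (_≟_)
open import Data.List using (List; map; foldr; allFin)
open import Data.Integer using (+_)
open import Data.Rational as ℚ using (ℚ; _/_)
open import Relation.Nullary using (¬_; does; yes; no)
open import Data.Empty using (⊥-elim)
open import Relation.Binary.PropositionalEquality using (_≡_; refl; subst; sym)
open import Function.Bundles using (_↔_; Inverse)
open import Data.Product using (Σ)

record Graph (n : ℕ) : Set where
  field
    adj    : Fin n → Fin n → Bool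
    adj-sym    : ∀ i j → adj i j ≡ adj j i
    adj-irrefl : ∀ i → adj i i ≡ false
open Graph public

[_] : Bool → ℕ
[ b ] = if b then 1 else 0

Σℕ : ∀ {n} → (Fin n → ℕ) → ℕ
Σℕ {n} f = foldr ℕ._+_ 0 (map f (allFin n))

Σℚ : ∀ {n} → (Fin n → ℚ) → ℚ
Σℚ {n} f = foldr ℚ._+_ ℚ.0ℚ (map f (allFin n))

degree : ∀ {n} → Graph n → Fin n → ℕ
degree G u = Σℕ (λ j → [ adj G u j ])

nbhdEdges : ∀ {n} → Graph n → Fin n → ℕ
nbhdEdges G u =
  Σℕ (λ j → Σℕ (λ k → [ (toℕ j <ᵇ toℕ k) ∧ adj G u j ∧ adj G u k ∧ adj G j k ]))

C2-nonZero : ∀ k → NonZero (suc (suc k) C 2)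
C2-nonZero k =
  subst NonZero (nCk+nC[k+1]≡[n+1]C[k+1] (suc k) 1)
    (subst (λ x → NonZero (x ℕ.+ (suc k C 2))) (sym (nC1≡n (suc k))) _)

localClustering : ∀ {n} → Graph n → Fin n → ℚ
localClustering G u with degree G u
... | zero        = ℚ.0ℚ
... | suc zero    = ℚ.0ℚ
... | suc (suc k) = ((+ nbhdEdges G u) / (suc (suc k) C 2)) {{C2-nonZero k}}

-- clustering coefficient C(G) = (1/n) Σ_u C_u(G)   (0 for the empty graph)
clustering : ∀ {n} → Graph n → ℚ
clustering {zero}  G = ℚ.0ℚ
clustering {suc m} G = Σℚ (localClustering G) ℚ.* ((+ 1) / suc m)

private
  swap-lemma : ∀ a p q r s → a ∨ (p ∧ q) ∨ (r ∧ s) ≡ a ∨ (s ∧ r) ∨ (q ∧ p)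
  swap-lemma false false false false false = refl
  swap-lemma false false false false true  = refl
  swap-lemma false false false true  false = refl
  swap-lemma false false false true  true  = refl
  swap-lemma false false true  false false = refl
  swap-lemma false false true  false true  = refl
  swap-lemma false false true  true  false = refl
  swap-lemma false false true  true  true  = refl
  swap-lemma false true  false false false = refl
  swap-lemma false true  false false true  = refl
  swap-lemma false true  false true  false = refl
  swap-lemma false true  false true  true  = refl
  swap-lemma false true  true  false false = refl
  swap-lemma false true  true  false true  = refl
  swap-lemma false true  true  true  false = refl
  swap-lemma false true  true  true  true  = refl
  swap-lemma true  _     _     _     _     = refl

  xor-comm : ∀ a b → a xor b ≡ b xor a
  xor-comm false false = refl
  xor-comm false true  = refl
  xor-comm true  false = refl
  xor-comm true  true  = refl

  xor-self : ∀ a → a xor a ≡ false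
  xor-self false = refl
  xor-self true  = refl

addEdge : ∀ {n} (G : Graph n) (u v : Fin n) → ¬ (u ≡ v) → Graph n
addEdge G u v u≢v = record
  { adj = A
  ; adj-sym = symP
  ; adj-irrefl = irr
  }
  where
  A : _ → _ → Bool
  A i j = adj G i j ∨ (does (i ≟ u) ∧ does (j ≟ v)) ∨ (does (i ≟ v) ∧ does (j ≟ u))
  symP : ∀ i j → A i j ≡ A j i
  symP i j rewrite Graph.adj-sym G i j =
    swap-lemma (adj G j i) (does (i ≟ u)) (does (j ≟ v)) (does (i ≟ v)) (does (j ≟ u))
  irr : ∀ i → A i i ≡ false
  irr i rewrite Graph.adj-irrefl G i with i ≟ u | i ≟ v
  ... | yes refl | yes refl = ⊥-elim (u≢v refl)
  ... | yes _    | no _     = refl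
  ... | no _     | yes _    = refl
  ... | no _     | no _     = refl

-- The complete bipartite graph K_{2,n-2} on Fin n:
-- parts {0,1} and {2,…,n-1}.
K2,n-2 : (n : ℕ) → Graph n
K2,n-2 n = record
  { adj    = λ i j → (toℕ i <ᵇ 2) xor (toℕ j <ᵇ 2)
  ; adj-sym    = λ i j → xor-comm (toℕ i <ᵇ 2) (toℕ j <ᵇ 2)
  ; adj-irrefl = λ i → xor-self (toℕ i <ᵇ 2)
  }

_≅_ : ∀ {n} → Graph n → Graph n → Set
_≅_ {n} G H = Σ (Fin n ↔ Fin n) λ f →
  ∀ i j → adj G i j ≡ adj H (Inverse.to f i) (Inverse.to f j)

bound : ℕ → ℚ
bound zero          = ℚ.0ℚ
bound (suc zero)    = ℚ.0ℚ
bound n@(suc (suc k)) =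
  ℚ.1ℚ ℚ.- (+ 2) / n ℚ.+ (+ 4) / (n ℕ.* suc k)

-- Adding uv changes only the local coefficients of u, v and of the common
-- neighbours of u and v. If u and v have k common neighbours, C_u and C_v each
-- grow by at most 2/(k+1): the degree grows by one and the neighbourhood gains
-- k edges. Any other vertex w gains at most the edge uv inside N(w), so C_w
-- grows by at most 1, and only if w is a common neighbour. Hence
-- n·(C(G+uv) - C(G)) ≤ 4/(k+1) + k, which increases with k, and k ≤ n-2 gives
-- the bound. Equality forces k = n-2, so every other vertex is adjacent to u
-- and v, and each gains exactly 1, which happens only at degree 2; the other
-- vertices are therefore independent and G is K_{2,n-2} with parts {u,v}.
-- Conversely K_{2,n-2} is triangle-free, and then every local bound is attained.

module Submission where

open import Defs

module Fractions where

  open import Data.Nat as ℕ using (ℕ; suc; _+_; _*_; _≤_)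
  import Data.Nat.Properties as ℕ
  open import Data.Nat.Solver using (module +-*-Solver)
  open import Data.Integer as ℤ using (+_; +≤+; +<+)
  import Data.Integer.Properties as ℤ
  open import Data.Rational as ℚ using (ℚ; _/_; toℚᵘ)
  import Data.Rational.Properties as ℚ
  open import Data.Rational.Unnormalised as ℚᵘ using (mkℚᵘ; *≤*; *<*)
  import Data.Rational.Unnormalised.Properties as ℚᵘ
  open import Data.Sum using (inj₁; inj₂)
  open import Relation.Nullary using (contradiction)
  open import Relation.Binary.PropositionalEquality

  open +-*-Solver

  toℚ : ℕ → ℚ
  toℚ a = + a / 1

  private
    toℚᵘ-/ : ∀ a c → toℚᵘ (+ a / suc c) ℚᵘ.≃ mkℚᵘ (+ a) c
    toℚᵘ-/ a c = ℚ.toℚᵘ-fromℚᵘ (mkℚᵘ (+ a) c)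

  /-+-/ : ∀ a b c d → + a / suc c ℚ.+ + b / suc d ≡ + (a * suc d + b * suc c) / (suc c * suc d)
  /-+-/ a b c d = ℚ.toℚᵘ-injective (begin
    toℚᵘ (+ a / suc c ℚ.+ + b / suc d)           ≈⟨ ℚ.toℚᵘ-homo-+ (+ a / suc c) (+ b / suc d) ⟩
    toℚᵘ (+ a / suc c) ℚᵘ.+ toℚᵘ (+ b / suc d)   ≈⟨ ℚᵘ.+-cong (toℚᵘ-/ a c) (toℚᵘ-/ b d) ⟩
    mkℚᵘ (+ a) c ℚᵘ.+ mkℚᵘ (+ b) d               ≡⟨ ℚᵘ./-cong numerator refl ⟩
    mkℚᵘ (+ (a * suc d + b * suc c)) _           ≈⟨ toℚᵘ-/ _ _ ⟨
    toℚᵘ (+ (a * suc d + b * suc c) / (suc c * suc d)) ∎)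
    where
    open ℚᵘ.≃-Reasoning
    numerator : + a ℤ.* + suc d ℤ.+ + b ℤ.* + suc c ≡ + (a * suc d + b * suc c)
    numerator = trans (cong₂ ℤ._+_ (sym (ℤ.pos-* a (suc d))) (sym (ℤ.pos-* b (suc c)))) (sym (ℤ.pos-+ (a * suc d) _))

  /-*-/ : ∀ a b c d → (+ a / suc c) ℚ.* (+ b / suc d) ≡ + (a * b) / (suc c * suc d)
  /-*-/ a b c d = ℚ.toℚᵘ-injective (begin
    toℚᵘ ((+ a / suc c) ℚ.* (+ b / suc d))       ≈⟨ ℚ.toℚᵘ-homo-* (+ a / suc c) (+ b / suc d) ⟩
    toℚᵘ (+ a / suc c) ℚᵘ.* toℚᵘ (+ b / suc d)   ≈⟨ ℚᵘ.*-cong (toℚᵘ-/ a c) (toℚᵘ-/ b d) ⟩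
    mkℚᵘ (+ a) c ℚᵘ.* mkℚᵘ (+ b) d               ≡⟨ ℚᵘ./-cong (sym (ℤ.pos-* a b)) refl ⟩
    mkℚᵘ (+ (a * b)) _                           ≈⟨ toℚᵘ-/ _ _ ⟨
    toℚᵘ (+ (a * b) / (suc c * suc d))           ∎)
    where open ℚᵘ.≃-Reasoning

  /-mono-≤ : ∀ {a b c d} → a * suc d ≤ b * suc c → + a / suc c ℚ.≤ + b / suc d
  /-mono-≤ {a} {b} {c} {d} ad≤bc = ℚ.toℚᵘ-cancel-≤
    (ℚᵘ.≤-respˡ-≃ (ℚᵘ.≃-sym (toℚᵘ-/ a c)) (ℚᵘ.≤-respʳ-≃ (ℚᵘ.≃-sym (toℚᵘ-/ b d))
      (*≤* (subst₂ ℤ._≤_ (ℤ.pos-* a (suc d)) (ℤ.pos-* b (suc c)) (+≤+ ad≤bc)))))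

  /-mono-< : ∀ {a b c d} → a * suc d ℕ.< b * suc c → + a / suc c ℚ.< + b / suc d
  /-mono-< {a} {b} {c} {d} ad<bc = ℚ.toℚᵘ-cancel-<
    (ℚᵘ.<-respˡ-≃ (ℚᵘ.≃-sym (toℚᵘ-/ a c)) (ℚᵘ.<-respʳ-≃ (ℚᵘ.≃-sym (toℚᵘ-/ b d))
      (*<* (subst₂ ℤ._<_ (ℤ.pos-* a (suc d)) (ℤ.pos-* b (suc c)) (+<+ ad<bc)))))

  /-cong-≡ : ∀ {a b c d} → a * suc d ≡ b * suc c → + a / suc c ≡ + b / suc d
  /-cong-≡ {a} {b} {c} {d} ad≡bc = ℚ.≤-antisym (/-mono-≤ {a} {b} {c} {d} (ℕ.≤-reflexive ad≡bc))
                                               (/-mono-≤ {b} {a} {d} {c} (ℕ.≤-reflexive (sym ad≡bc)))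

  /-injective : ∀ {a b c d} → + a / suc c ≡ + b / suc d → a * suc d ≡ b * suc c
  /-injective {a} {b} {c} {d} = ℚ.normalize-injective-≃ a b (suc c) (suc d)

  /-+-same : ∀ a b c → + a / suc c ℚ.+ + b / suc c ≡ + (a + b) / suc c
  /-+-same a b c = trans (/-+-/ a b c c) (/-cong-≡ {a * suc c + b * suc c} {a + b} {c + c * suc c} {c} (solve 3 (λ a b c →
    (a :* c :+ b :* c) :* c := (a :+ b) :* (c :* c)) refl a b (suc c)))

  toℚ-+ : ∀ a b → toℚ a ℚ.+ toℚ b ≡ toℚ (a + b)
  toℚ-+ a b = /-+-same a b 0

  +-cancelˡ-≤ : ∀ x {y z} → x ℚ.+ y ℚ.≤ x ℚ.+ z → y ℚ.≤ z
  +-cancelˡ-≤ x {y} {z} x+y≤x+z = subst₂ ℚ._≤_ (-x+[x+t]≡t y) (-x+[x+t]≡t z) (ℚ.+-monoʳ-≤ (ℚ.- x) x+y≤x+z)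
    where
    -x+[x+t]≡t : ∀ t → ℚ.- x ℚ.+ (x ℚ.+ t) ≡ t
    -x+[x+t]≡t t = trans (sym (ℚ.+-assoc (ℚ.- x) x t)) (trans (cong (ℚ._+ t) (ℚ.+-inverseˡ x)) (ℚ.+-identityˡ t))

  +-cancelˡ-≡ : ∀ x {y z} → x ℚ.+ y ≡ x ℚ.+ z → y ≡ z
  +-cancelˡ-≡ x x+y≡x+z = ℚ.≤-antisym (+-cancelˡ-≤ x (ℚ.≤-reflexive x+y≡x+z))
                                      (+-cancelˡ-≤ x (ℚ.≤-reflexive (sym x+y≡x+z)))

  module StrictlyIncreasing (f : ℕ → ℚ) (f<f∘suc : ∀ k → f k ℚ.< f (suc k)) where

    mono-< : ∀ {k m} → k ℕ.< m → f k ℚ.< f m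
    mono-< k<m = go (ℕ.≤⇒≤′ k<m)
      where
      go : ∀ {k m} → suc k ℕ.≤′ m → f k ℚ.< f m
      go ℕ.≤′-refl        = f<f∘suc _
      go (ℕ.≤′-step k<m)  = ℚ.<-trans (go k<m) (f<f∘suc _)

    mono-≤ : ∀ {k m} → k ≤ m → f k ℚ.≤ f m
    mono-≤ k≤m with ℕ.m≤n⇒m<n∨m≡n k≤m
    ... | inj₁ k<m  = ℚ.<⇒≤ (mono-< k<m)
    ... | inj₂ refl = ℚ.≤-refl

    mono-≡⇒≡ : ∀ {k m} → k ≤ m → f k ≡ f m → k ≡ m
    mono-≡⇒≡ k≤m fk≡fm with ℕ.m≤n⇒m<n∨m≡n k≤m
    ... | inj₁ k<m  = contradiction fk≡fm (ℚ.<⇒≢ (mono-< k<m))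
    ... | inj₂ k≡m = k≡m

module FiniteSums where

  open import Algebra.Bundles using (Monoid)
  import Algebra.Properties.Monoid.Sum as MonoidSum
  import Algebra.Properties.CommutativeMonoid.Sum as CommutativeMonoidSum
  open import Data.Bool using (Bool; true; false; if_then_else_)
  open import Data.Fin using (Fin; zero; suc)
  open import Data.Fin.Properties using (_≟_)
  open import Data.List using (map; foldr; tabulate)
  open import Data.Nat as ℕ using (ℕ; zero; suc; _+_; _≤_; z≤n)
  import Data.Nat.Properties as ℕ
  open import Data.Rational as ℚ using (ℚ)
  import Data.Rational.Properties as ℚ
  import Data.Vec.Functional as Vector
  open import Function using (_∘_; id)
  open import Relation.Nullary using (does)
  open import Relation.Binary.PropositionalEquality

  open Fractions using (toℚ; toℚ-+; +-cancelˡ-≤)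

  module _ {a ℓ} (M : Monoid a ℓ) where
    open Monoid M using (_≈_; _∙_; ε; ∙-congˡ; identityˡ; identityʳ) renaming (trans to ≈-trans)
    open MonoidSum M using (sum; sum-replicate-zero)

    sum-at : ∀ {n} (i : Fin n) x → sum (λ j → if does (j ≟ i) then x else ε) ≈ x
    sum-at {suc n} zero    x = ≈-trans (∙-congˡ (sum-replicate-zero n)) (identityʳ x)
    sum-at {suc n} (suc i) x = ≈-trans (identityˡ _) (sum-at i x)

  open CommutativeMonoidSum ℕ.+-0-commutativeMonoid public
    using (sum; sum-cong-≗; ∑-distrib-+; sum-replicate-zero)
  open CommutativeMonoidSum ℚ.+-0-commutativeMonoid public
    using () renaming (sum to sumℚ; sum-cong-≗ to sumℚ-cong-≗; ∑-distrib-+ to ∑ℚ-distrib-+)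

  foldr-map-tabulate : ∀ {A : Set} (_∙_ : A → A → A) (ε : A) {m n} (g : Fin n → Fin m) (f : Fin m → A) →
                       foldr _∙_ ε (map f (tabulate g)) ≡ Vector.foldr _∙_ ε (f ∘ g)
  foldr-map-tabulate _∙_ ε {n = zero}  g f = refl
  foldr-map-tabulate _∙_ ε {n = suc n} g f = cong (f (g zero) ∙_) (foldr-map-tabulate _∙_ ε (g ∘ suc) f)

  Σℕ≡sum : ∀ {n} (f : Fin n → ℕ) → Σℕ f ≡ sum f
  Σℕ≡sum = foldr-map-tabulate _+_ 0 id

  Σℚ≡sumℚ : ∀ {n} (f : Fin n → ℚ) → Σℚ f ≡ sumℚ f
  Σℚ≡sumℚ = foldr-map-tabulate ℚ._+_ ℚ.0ℚ id

  sum-if : ∀ {n} (b : Bool) (f : Fin n → ℕ) → sum (λ i → if b then f i else 0) ≡ (if b then sum f else 0)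
  sum-if {n} true  f = refl
  sum-if {n} false f = sum-replicate-zero n

  sum-zero : ∀ {n} {f : Fin n → ℕ} → (∀ i → f i ≡ 0) → sum f ≡ 0
  sum-zero {n} f≡0 = trans (sum-cong-≗ f≡0) (sum-replicate-zero n)

  sum-mono-≤ : ∀ {n} {f g : Fin n → ℕ} → (∀ i → f i ≤ g i) → sum f ≤ sum g
  sum-mono-≤ {zero}  _   = z≤n
  sum-mono-≤ {suc n} f≤g = ℕ.+-mono-≤ (f≤g zero) (sum-mono-≤ (f≤g ∘ suc))

  sum-mono-≤-tight : ∀ {n} {f g : Fin n → ℕ} → (∀ i → f i ≤ g i) → sum g ≤ sum f → ∀ i → f i ≡ g i
  sum-mono-≤-tight {suc n} {f} {g} f≤g Σg≤Σf zero = ℕ.≤-antisym (f≤g zero)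
    (ℕ.+-cancelʳ-≤ _ _ _ (ℕ.≤-trans Σg≤Σf (ℕ.+-monoʳ-≤ (f zero) (sum-mono-≤ (f≤g ∘ suc)))))
  sum-mono-≤-tight {suc n} {f} {g} f≤g Σg≤Σf (suc i) = sum-mono-≤-tight (f≤g ∘ suc)
    (ℕ.+-cancelˡ-≤ (g zero) _ _ (ℕ.≤-trans Σg≤Σf (ℕ.+-monoˡ-≤ _ (f≤g zero)))) i

  sumℚ-mono-≤ : ∀ {n} {f g : Fin n → ℚ} → (∀ i → f i ℚ.≤ g i) → sumℚ f ℚ.≤ sumℚ g
  sumℚ-mono-≤ {zero}  _   = ℚ.≤-refl
  sumℚ-mono-≤ {suc n} f≤g = ℚ.+-mono-≤ (f≤g zero) (sumℚ-mono-≤ (f≤g ∘ suc))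

  sumℚ-mono-≤-tight : ∀ {n} {f g : Fin n → ℚ} → (∀ i → f i ℚ.≤ g i) → sumℚ g ℚ.≤ sumℚ f →
                      ∀ i → f i ≡ g i
  sumℚ-mono-≤-tight {suc n} {f} {g} f≤g Σg≤Σf zero = ℚ.≤-antisym (f≤g zero)
    (+-cancelˡ-≤ (sumℚ (g ∘ suc)) (subst₂ ℚ._≤_ (ℚ.+-comm (g zero) _) (ℚ.+-comm (f zero) _)
      (ℚ.≤-trans Σg≤Σf (ℚ.+-monoʳ-≤ (f zero) (sumℚ-mono-≤ (f≤g ∘ suc))))))
  sumℚ-mono-≤-tight {suc n} {f} {g} f≤g Σg≤Σf (suc i) = sumℚ-mono-≤-tight (f≤g ∘ suc)
    (+-cancelˡ-≤ (g zero) (ℚ.≤-trans Σg≤Σf (ℚ.+-monoˡ-≤ _ (f≤g zero)))) i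

  sumℚ-toℚ : ∀ {n} (f : Fin n → ℕ) → sumℚ (toℚ ∘ f) ≡ toℚ (sum f)
  sumℚ-toℚ {zero}  f = refl
  sumℚ-toℚ {suc n} f = trans (cong (toℚ (f zero) ℚ.+_) (sumℚ-toℚ (f ∘ suc))) (toℚ-+ (f zero) _)

module Counting where

  open import Data.Bool using (Bool; true; false; not)
  open import Data.Bool.Properties using (not-injective)
  open import Data.Fin using (Fin)
  open import Data.Fin.Properties using (_≟_)
  open import Data.Nat as ℕ using (ℕ; zero; suc; _+_; _≤_; z≤n)
  import Data.Nat.Properties as ℕ
  open import Function using (_∘_; _⇔_; mk⇔; Equivalence)
  open import Relation.Nullary using (does; yes; no; contradiction)
  open import Relation.Nullary.Decidable using (dec-false)
  open import Relation.Binary.PropositionalEquality hiding ([_])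

  open FiniteSums

  count : ∀ {n} → (Fin n → Bool) → ℕ
  count b = sum (λ i → [ b i ])

  count-complement : ∀ {n} (b : Fin n → Bool) → count b + count (not ∘ b) ≡ n
  count-complement {n} b = begin
    count b + count (not ∘ b)              ≡⟨ ∑-distrib-+ (λ i → [ b i ]) (λ i → [ not (b i) ]) ⟨
    sum (λ i → [ b i ] + [ not (b i) ])    ≡⟨ sum-cong-≗ (λ i → [b]+[not-b]≡1 (b i)) ⟩
    sum {n} (λ _ → 1)                      ≡⟨ sum-const-1 n ⟩
    n                                      ∎
    where
    open ≡-Reasoning
    [b]+[not-b]≡1 : ∀ c → [ c ] + [ not c ] ≡ 1
    [b]+[not-b]≡1 true  = refl
    [b]+[not-b]≡1 false = refl
    sum-const-1 : ∀ n → sum {n} (λ _ → 1) ≡ n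
    sum-const-1 zero    = refl
    sum-const-1 (suc n) = cong suc (sum-const-1 n)

  module _ {n} {x y : Fin n} (x≢y : x ≢ y) where

    private
      pair : Fin n → ℕ
      pair z = [ does (z ≟ x) ] + [ does (z ≟ y) ]

      sum-pair : sum pair ≡ 2
      sum-pair = trans (∑-distrib-+ (λ z → [ does (z ≟ x) ]) (λ z → [ does (z ≟ y) ]))
                       (cong₂ _+_ (sum-at ℕ.+-0-monoid x 1) (sum-at ℕ.+-0-monoid y 1))

      pair-outside : ∀ {z} → z ≢ x → z ≢ y → pair z ≡ 0
      pair-outside z≢x z≢y rewrite dec-false (_ ≟ x) z≢x | dec-false (_ ≟ y) z≢y = refl

    module _ {b : Fin n → Bool} (bx : b x ≡ true) (by : b y ≡ true) where

      private
        pair≤b : ∀ z → pair z ≤ [ b z ]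
        pair≤b z with z ≟ x | z ≟ y
        ... | yes refl | yes z≡y = contradiction z≡y x≢y
        ... | yes refl | no _    rewrite bx = ℕ.≤-refl
        ... | no _     | yes refl rewrite by = ℕ.≤-refl
        ... | no _     | no _    = z≤n

      2≤count : 2 ≤ count b
      2≤count = subst (_≤ count b) sum-pair (sum-mono-≤ pair≤b)

      count≡2⇔ : count b ≡ 2 ⇔ (∀ z → z ≢ x → z ≢ y → b z ≡ false)
      count≡2⇔ = mk⇔ only-two two-only
        where
        only-two : count b ≡ 2 → ∀ z → z ≢ x → z ≢ y → b z ≡ false
        only-two count≡2 z z≢x z≢y with b z | sum-mono-≤-tight pair≤b (ℕ.≤-reflexive (trans count≡2 (sym sum-pair))) z
        ... | false | _ = refl
        ... | true  | eq = contradiction (trans (sym (pair-outside z≢x z≢y)) eq) λ ()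
        two-only : (∀ z → z ≢ x → z ≢ y → b z ≡ false) → count b ≡ 2
        two-only outside = trans (sum-cong-≗ b≡pair) sum-pair
          where
          b≡pair : ∀ z → [ b z ] ≡ pair z
          b≡pair z with z ≟ x | z ≟ y
          ... | yes refl | yes z≡y = contradiction z≡y x≢y
          ... | yes refl | no _    rewrite bx = refl
          ... | no _     | yes refl rewrite by = refl
          ... | no z≢x   | no z≢y  rewrite outside z z≢x z≢y = refl

    module _ {b : Fin n → Bool} (bx : b x ≡ false) (by : b y ≡ false) where

      count+2≤ : count b + 2 ≤ n
      count+2≤ = subst (count b + 2 ≤_) (count-complement b)
                       (ℕ.+-monoʳ-≤ (count b) (2≤count (cong not bx) (cong not by)))

      count+2≡⇔ : count b + 2 ≡ n ⇔ (∀ z → z ≢ x → z ≢ y → b z ≡ true)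
      count+2≡⇔ = mk⇔
        (λ count+2≡n z z≢x z≢y → not-injective (Equivalence.to not-b-count≡2⇔
           (sym (ℕ.+-cancelˡ-≡ (count b) _ _ (trans count+2≡n (sym (count-complement b))))) z z≢x z≢y))
        (λ inside → trans (cong (count b +_) (sym (Equivalence.from not-b-count≡2⇔
           (λ z z≢x z≢y → cong not (inside z z≢x z≢y))))) (count-complement b))
        where
        not-b-count≡2⇔ : count (not ∘ b) ≡ 2 ⇔ (∀ z → z ≢ x → z ≢ y → not (b z) ≡ false)
        not-b-count≡2⇔ = count≡2⇔ {not ∘ b} (cong not bx) (cong not by)

module NeighbourhoodEdges where

  open import Data.Bool using (Bool; true; false; if_then_else_; _∧_; _∨_)
  open import Data.Bool.Properties using (∧-zeroʳ; ∨-identityʳ; ∧-comm; ∨-comm)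
  open import Data.Fin using (Fin; zero; suc; toℕ)
  open import Data.Fin.Properties using (_≟_; toℕ-injective)
  open import Data.Nat as ℕ using (ℕ; zero; suc; _+_; _≤_; z≤n; _<ᵇ_)
  import Data.Nat.Properties as ℕ
  open import Data.Sum using (_⊎_; inj₁; inj₂; [_,_]′)
  open import Function using (_∘_)
  open import Relation.Nullary using (does; yes; no; contradiction)
  open import Relation.Nullary.Decidable using (dec-true; dec-false)
  open import Relation.Binary.PropositionalEquality hiding ([_])

  open FiniteSums
  open Counting

  <ᵇ-irrefl : ∀ m → (m <ᵇ m) ≡ false
  <ᵇ-irrefl zero    = refl
  <ᵇ-irrefl (suc m) = <ᵇ-irrefl m

  <ᵇ-one-way : ∀ {m n} → m ≢ n → ∀ c → [ (m <ᵇ n) ∧ c ] + [ (n <ᵇ m) ∧ c ] ≡ [ c ]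
  <ᵇ-one-way {zero}  {zero}  m≢n c = contradiction refl m≢n
  <ᵇ-one-way {zero}  {suc n} m≢n c = ℕ.+-identityʳ [ c ]
  <ᵇ-one-way {suc m} {zero}  m≢n c = refl
  <ᵇ-one-way {suc m} {suc n} m≢n c = <ᵇ-one-way (m≢n ∘ cong suc) c

  isNbhdEdge : ∀ {n} → (Fin n → Fin n → Bool) → Fin n → Fin n → Fin n → ℕ
  isNbhdEdge A w j k = [ (toℕ j <ᵇ toℕ k) ∧ A w j ∧ A w k ∧ A j k ]

  nbhdEdges≡sum : ∀ {n} (G : Graph n) w → nbhdEdges G w ≡ sum (λ j → sum (isNbhdEdge (adj G) w j))
  nbhdEdges≡sum {n} G w = trans (Σℕ≡sum {n} _) (sum-cong-≗ {n} (λ j → Σℕ≡sum {n} _))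

  degree≡count : ∀ {n} (G : Graph n) w → degree G w ≡ count (adj G w)
  degree≡count {n} G w = Σℕ≡sum {n} _

  private
    nbhdEdges≡0 : ∀ {n} (G : Graph n) w → (∀ j k → isNbhdEdge (adj G) w j k ≡ 0) → nbhdEdges G w ≡ 0
    nbhdEdges≡0 G w none = trans (nbhdEdges≡sum G w) (sum-zero (λ j → sum-zero (none j)))

  nbhdEdges-degree≤1 : ∀ {n} (G : Graph n) w → degree G w ≤ 1 → nbhdEdges G w ≡ 0
  nbhdEdges-degree≤1 G w deg≤1 = nbhdEdges≡0 G w none
    where
    none : ∀ j k → isNbhdEdge (adj G) w j k ≡ 0
    none j k with j ≟ k
    ... | yes refl rewrite <ᵇ-irrefl (toℕ j) = refl
    ... | no j≢k with toℕ j <ᵇ toℕ k | adj G w j in wj | adj G w k in wk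
    ... | false | _     | _     = refl
    ... | true  | false | _     = refl
    ... | true  | true  | false = refl
    ... | true  | true  | true  = contradiction (ℕ.≤-trans 2≤degree deg≤1) λ { (ℕ.s≤s ()) }
      where
      2≤degree : 2 ≤ degree G w
      2≤degree = subst (2 ≤_) (sym (degree≡count G w)) (2≤count j≢k wj wk)

  TriangleFree : ∀ {n} → Graph n → Set
  TriangleFree G = ∀ a b c → adj G a b ≡ true → adj G b c ≡ true → adj G a c ≡ false

  nbhdEdges-triangleFree : ∀ {n} (G : Graph n) → TriangleFree G → ∀ w → nbhdEdges G w ≡ 0
  nbhdEdges-triangleFree G triangleFree w = nbhdEdges≡0 G w none
    where
    none : ∀ j k → isNbhdEdge (adj G) w j k ≡ 0
    none j k with toℕ j <ᵇ toℕ k | adj G w j in wj | adj G j k in jk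
    ... | false | _     | _     = refl
    ... | true  | false | _     = refl
    ... | true  | true  | false rewrite ∧-zeroʳ (adj G w k) = refl
    ... | true  | true  | true  rewrite triangleFree w j k wj jk = refl

  newEdge : ∀ {n} → Fin n → Fin n → Fin n → Fin n → Bool
  newEdge u v i j = does (i ≟ u) ∧ does (j ≟ v) ∨ does (i ≟ v) ∧ does (j ≟ u)

  newEdge-sym : ∀ {n} (u v i j : Fin n) → newEdge u v i j ≡ newEdge v u i j
  newEdge-sym u v i j = ∨-comm (does (i ≟ u) ∧ does (j ≟ v)) (does (i ≟ v) ∧ does (j ≟ u))

  commonNeighbours : ∀ {n} → Graph n → Fin n → Fin n → ℕ
  commonNeighbours G u v = count (λ x → adj G u x ∧ adj G v x)

  commonNeighbours-comm : ∀ {n} (G : Graph n) u v → commonNeighbours G v u ≡ commonNeighbours G u v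
  commonNeighbours-comm G u v = sum-cong-≗ (λ x → cong [_] (∧-comm (adj G v x) (adj G u x)))

  commonNeighbours-≤-degree : ∀ {n} (G : Graph n) u v → commonNeighbours G u v ≤ degree G u
  commonNeighbours-≤-degree G u v = subst (commonNeighbours G u v ≤_) (sym (degree≡count G u))
    (sum-mono-≤ (λ x → [a∧b]≤[a] (adj G u x) (adj G v x)))
    where
    [a∧b]≤[a] : ∀ a b → [ a ∧ b ] ≤ [ a ]
    [a∧b]≤[a] false b     = z≤n
    [a∧b]≤[a] true  false = z≤n
    [a∧b]≤[a] true  true  = ℕ.≤-refl

  -- G' is any graph with the adjacency of G + uv, so that the module also
  -- applies to addEdge G u v with the roles of u and v exchanged.
  module AddedEdge {n} (G G' : Graph n) {u v : Fin n} (u≢v : u ≢ v) (u≁v : adj G u v ≡ false)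
                   (adj-G' : ∀ i j → adj G' i j ≡ adj G i j ∨ newEdge u v i j) where

    private
      A A' : Fin n → Fin n → Bool
      A  = adj G
      A' = adj G'

      v≢u : v ≢ u
      v≢u = u≢v ∘ sym

      v≁u : A v u ≡ false
      v≁u = trans (adj-sym G v u) u≁v

      u≟u : does (u ≟ u) ≡ true
      u≟u = dec-true (u ≟ u) refl
      v≟v : does (v ≟ v) ≡ true
      v≟v = dec-true (v ≟ v) refl
      u≟v : does (u ≟ v) ≡ false
      u≟v = dec-false (u ≟ v) u≢v
      v≟u : does (v ≟ u) ≡ false
      v≟u = dec-false (v ≟ u) v≢u

    degree-endpoint : degree G' u ≡ suc (degree G u)
    degree-endpoint = begin
      degree G' u                                     ≡⟨ degree≡count G' u ⟩
      count (A' u)                                    ≡⟨ sum-cong-≗ [A'uj]≡ ⟩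
      sum (λ j → [ A u j ] + [ does (j ≟ v) ])        ≡⟨ ∑-distrib-+ (λ j → [ A u j ]) (λ j → [ does (j ≟ v) ]) ⟩
      count (A u) + sum (λ j → [ does (j ≟ v) ])      ≡⟨ cong (count (A u) +_) (sum-at ℕ.+-0-monoid v 1) ⟩
      count (A u) + 1                                 ≡⟨ ℕ.+-comm _ 1 ⟩
      suc (count (A u))                               ≡⟨ cong suc (degree≡count G u) ⟨
      suc (degree G u)                                ∎
      where
      open ≡-Reasoning
      [A'uj]≡ : ∀ j → [ A' u j ] ≡ [ A u j ] + [ does (j ≟ v) ]
      [A'uj]≡ j rewrite adj-G' u j | u≟u | u≟v with j ≟ v
      ... | yes refl rewrite u≁v = refl
      ... | no _ with A u j
      ...   | true  = refl
      ...   | false = refl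

    degree-other : ∀ {w} → w ≢ u → w ≢ v → degree G' w ≡ degree G w
    degree-other {w} w≢u w≢v = begin
      degree G' w    ≡⟨ degree≡count G' w ⟩
      count (A' w)   ≡⟨ sum-cong-≗ (λ j → cong [_] (A'wj≡ j)) ⟩
      count (A w)    ≡⟨ degree≡count G w ⟨
      degree G w     ∎
      where
      open ≡-Reasoning
      A'wj≡ : ∀ j → A' w j ≡ A w j
      A'wj≡ j rewrite adj-G' w j | dec-false (w ≟ u) w≢u | dec-false (w ≟ v) w≢v = ∨-identityʳ (A w j)

    -- The new edges of G'[N(u)] join v to the common neighbours, counted at
    -- (v, k) or at (j, v) according to the order of the endpoints.
    private
      commonAbove commonBelow : Fin n → ℕ
      commonAbove k = [ (toℕ v <ᵇ toℕ k) ∧ A u k ∧ A v k ]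
      commonBelow j = [ (toℕ j <ᵇ toℕ v) ∧ A u j ∧ A v j ]

      isNbhdEdge-u-vv : isNbhdEdge A' u v v ≡ isNbhdEdge A u v v + commonAbove v + commonBelow v
      isNbhdEdge-u-vv rewrite <ᵇ-irrefl (toℕ v) = refl

      isNbhdEdge-u-vk : ∀ k → k ≢ v → isNbhdEdge A' u v k ≡ isNbhdEdge A u v k + commonAbove k + 0
      isNbhdEdge-u-vk k k≢v rewrite adj-G' u v | adj-G' u k | adj-G' v k | u≟u | v≟v | u≟v | v≟u
                                   | dec-false (k ≟ v) k≢v | u≁v with k ≟ u
      ... | yes refl rewrite adj-irrefl G u with toℕ v <ᵇ toℕ u
      ...   | false = refl
      ...   | true  = refl
      isNbhdEdge-u-vk k k≢v | no k≢u with toℕ v <ᵇ toℕ k | A u k | A v k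
      ... | false | _     | _     = refl
      ... | true  | false | _     = refl
      ... | true  | true  | false = refl
      ... | true  | true  | true  = refl

      isNbhdEdge-u-jv : ∀ j → j ≢ v → isNbhdEdge A' u j v ≡ isNbhdEdge A u j v + 0 + commonBelow j
      isNbhdEdge-u-jv j j≢v rewrite adj-G' u v | adj-G' u j | adj-G' j v | u≟u | v≟v | u≟v | v≟u
                                   | dec-false (j ≟ v) j≢v | u≁v | adj-sym G j v with j ≟ u
      ... | yes refl rewrite adj-irrefl G u with toℕ u <ᵇ toℕ v
      ...   | false = refl
      ...   | true  = refl
      isNbhdEdge-u-jv j j≢v | no j≢u with toℕ j <ᵇ toℕ v | A u j | A v j
      ... | false | _     | _     = refl
      ... | true  | false | _     = refl
      ... | true  | true  | false = refl
      ... | true  | true  | true  = refl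

      isNbhdEdge-u-jk : ∀ j k → j ≢ v → k ≢ v → isNbhdEdge A' u j k ≡ isNbhdEdge A u j k + 0 + 0
      isNbhdEdge-u-jk j k j≢v k≢v rewrite adj-G' u j | adj-G' u k | adj-G' j k | u≟u | u≟v
                                         | dec-false (j ≟ v) j≢v | dec-false (k ≟ v) k≢v
                                         with toℕ j <ᵇ toℕ k | A u j | A u k | A j k | does (j ≟ u)
      ... | false | _     | _     | _     | _     = refl
      ... | true  | false | _     | _     | _     = refl
      ... | true  | true  | false | _     | _     = refl
      ... | true  | true  | true  | false | false = refl
      ... | true  | true  | true  | false | true  = refl
      ... | true  | true  | true  | true  | _     = refl

      isNbhdEdge-u : ∀ j k → isNbhdEdge A' u j k ≡ isNbhdEdge A u j k
                       + (if does (j ≟ v) then commonAbove k else 0) + (if does (k ≟ v) then commonBelow j else 0)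
      isNbhdEdge-u j k with j ≟ v | k ≟ v
      ... | yes refl | yes refl = isNbhdEdge-u-vv
      ... | yes refl | no k≢v   = isNbhdEdge-u-vk k k≢v
      ... | no j≢v   | yes refl = isNbhdEdge-u-jv j j≢v
      ... | no j≢v   | no k≢v   = isNbhdEdge-u-jk j k j≢v k≢v

      commonAbove+commonBelow : ∀ x → commonAbove x + commonBelow x ≡ [ A u x ∧ A v x ]
      commonAbove+commonBelow x with x ≟ v
      ... | yes refl rewrite <ᵇ-irrefl (toℕ v) | u≁v = refl
      ... | no x≢v = <ᵇ-one-way (x≢v ∘ sym ∘ toℕ-injective) (A u x ∧ A v x)

    nbhdEdges-endpoint : nbhdEdges G' u ≡ nbhdEdges G u + commonNeighbours G u v
    nbhdEdges-endpoint = begin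
      nbhdEdges G' u
        ≡⟨ nbhdEdges≡sum G' u ⟩
      sum (λ j → sum (isNbhdEdge A' u j))
        ≡⟨ sum-cong-≗ {n} (λ j → sum-cong-≗ {n} (isNbhdEdge-u j)) ⟩
      sum (λ j → sum (λ k → E j k + (if does (j ≟ v) then commonAbove k else 0) + (if does (k ≟ v) then commonBelow j else 0)))
        ≡⟨ sum-cong-≗ {n} inner ⟩
      sum (λ j → sum (E j) + (if does (j ≟ v) then sum commonAbove else 0) + commonBelow j)
        ≡⟨ ∑-distrib-+ {n} _ commonBelow ⟩
      sum (λ j → sum (E j) + (if does (j ≟ v) then sum commonAbove else 0)) + sum commonBelow
        ≡⟨ cong (_+ sum commonBelow) (∑-distrib-+ {n} _ _) ⟩
      sum (λ j → sum (E j)) + sum (λ j → if does (j ≟ v) then sum commonAbove else 0) + sum commonBelow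
        ≡⟨ cong (λ x → sum (λ j → sum (E j)) + x + sum commonBelow) (sum-at ℕ.+-0-monoid v _) ⟩
      sum (λ j → sum (E j)) + sum commonAbove + sum commonBelow
        ≡⟨ ℕ.+-assoc (sum (λ j → sum (E j))) (sum commonAbove) (sum commonBelow) ⟩
      sum (λ j → sum (E j)) + (sum commonAbove + sum commonBelow)
        ≡⟨ cong₂ _+_ (sym (nbhdEdges≡sum G u))
                     (trans (sym (∑-distrib-+ commonAbove commonBelow)) (sum-cong-≗ commonAbove+commonBelow)) ⟩
      nbhdEdges G u + commonNeighbours G u v
        ∎
      where
      open ≡-Reasoning
      E : Fin n → Fin n → ℕ
      E = isNbhdEdge A u
      inner : ∀ j → sum (λ k → E j k + (if does (j ≟ v) then commonAbove k else 0) + (if does (k ≟ v) then commonBelow j else 0))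
                  ≡ sum (E j) + (if does (j ≟ v) then sum commonAbove else 0) + commonBelow j
      inner j = trans (∑-distrib-+ {n} _ _) (cong₂ _+_
        (trans (∑-distrib-+ {n} (E j) _) (cong (sum (E j) +_) (sum-if (does (j ≟ v)) commonAbove)))
        (sum-at ℕ.+-0-monoid v (commonBelow j)))

    module _ {w : Fin n} (w≢u : w ≢ u) (w≢v : w ≢ v) where

      private
        w≟u : does (w ≟ u) ≡ false
        w≟u = dec-false (w ≟ u) w≢u
        w≟v : does (w ≟ v) ≡ false
        w≟v = dec-false (w ≟ v) w≢v

        c : Bool
        c = A w u ∧ A w v

        c-uv c-vu : ℕ
        c-uv = [ (toℕ u <ᵇ toℕ v) ∧ c ]
        c-vu = [ (toℕ v <ᵇ toℕ u) ∧ c ]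

        at : Fin n → ℕ → Fin n → ℕ
        at i x j = if does (j ≟ i) then x else 0

        new : Fin n → Fin n → ℕ
        new j k = at u (at v c-uv k) j + at v (at u c-vu k) j

        isNbhdEdge-old : ∀ j k → newEdge u v j k ≡ false → isNbhdEdge A' w j k ≡ isNbhdEdge A w j k + 0
        isNbhdEdge-old j k old rewrite adj-G' w j | adj-G' w k | adj-G' j k | old | w≟u | w≟v
                                     with toℕ j <ᵇ toℕ k | A w j | A w k | A j k
        ... | false | _     | _     | _     = refl
        ... | true  | false | _     | _     = refl
        ... | true  | true  | false | _     = refl
        ... | true  | true  | true  | false = refl
        ... | true  | true  | true  | true  = refl

        isNbhdEdge-uv : isNbhdEdge A' w u v ≡ isNbhdEdge A w u v + c-uv
        isNbhdEdge-uv rewrite adj-G' w u | adj-G' w v | adj-G' u v | w≟u | w≟v | u≟u | v≟v | u≁v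
                      with toℕ u <ᵇ toℕ v | A w u | A w v
        ... | false | _     | _     = refl
        ... | true  | false | _     = refl
        ... | true  | true  | false = refl
        ... | true  | true  | true  = refl

        isNbhdEdge-vu : isNbhdEdge A' w v u ≡ isNbhdEdge A w v u + c-vu
        isNbhdEdge-vu rewrite adj-G' w u | adj-G' w v | adj-G' v u | w≟u | w≟v | u≟u | v≟v | v≟u | v≁u
                      with toℕ v <ᵇ toℕ u | A w u | A w v
        ... | false | _     | _     = refl
        ... | true  | false | false = refl
        ... | true  | false | true  = refl
        ... | true  | true  | false = refl
        ... | true  | true  | true  = refl

        old-edge : ∀ {j k} → j ≢ u ⊎ k ≢ v → j ≢ v ⊎ k ≢ u → newEdge u v j k ≡ false
        old-edge {j} {k} not-uv not-vu with j ≟ u | k ≟ v | j ≟ v | k ≟ u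
        ... | yes j≡u | yes k≡v | _       | _       = [ contradiction j≡u , contradiction k≡v ]′ not-uv
        ... | _       | _       | yes j≡v | yes k≡u = [ contradiction j≡v , contradiction k≡u ]′ not-vu
        ... | yes _   | no _    | no _    | _       = refl
        ... | yes _   | no _    | yes _   | no _    = refl
        ... | no _    | _       | no _    | _       = refl
        ... | no _    | _       | yes _   | no _    = refl

        isNbhdEdge-w : ∀ j k → isNbhdEdge A' w j k ≡ isNbhdEdge A w j k + new j k
        isNbhdEdge-w j k with j ≟ u | k ≟ v | j ≟ v | k ≟ u
        ... | yes refl | _        | yes j≡v | _        = contradiction j≡v u≢v
        ... | yes refl | yes refl | no _    | _        = trans isNbhdEdge-uv (cong (isNbhdEdge A w u v +_) (sym (ℕ.+-identityʳ c-uv)))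
        ... | yes refl | no k≢v   | no j≢v  | _        = isNbhdEdge-old j k (old-edge {j} {k} (inj₂ k≢v) (inj₁ j≢v))
        ... | no j≢u   | _        | yes refl | yes refl = isNbhdEdge-vu
        ... | no j≢u   | _        | yes refl | no k≢u  = isNbhdEdge-old j k (old-edge {j} {k} (inj₁ j≢u) (inj₂ k≢u))
        ... | no j≢u   | _        | no j≢v   | _       = isNbhdEdge-old j k (old-edge {j} {k} (inj₁ j≢u) (inj₁ j≢v))

        sum-new : sum (λ j → sum (new j)) ≡ [ c ]
        sum-new = begin
          sum (λ j → sum (new j))
            ≡⟨ sum-cong-≗ {n} (λ j → trans (∑-distrib-+ {n} _ _)
                 (cong₂ _+_ (sum-if (does (j ≟ u)) (at v c-uv)) (sum-if (does (j ≟ v)) (at u c-vu)))) ⟩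
          sum (λ j → at u (sum (at v c-uv)) j + at v (sum (at u c-vu)) j)
            ≡⟨ ∑-distrib-+ {n} (at u (sum (at v c-uv))) (at v (sum (at u c-vu))) ⟩
          sum (at u (sum (at v c-uv))) + sum (at v (sum (at u c-vu)))
            ≡⟨ cong₂ _+_ (trans (sum-at ℕ.+-0-monoid u _) (sum-at ℕ.+-0-monoid v c-uv))
                          (trans (sum-at ℕ.+-0-monoid v _) (sum-at ℕ.+-0-monoid u c-vu)) ⟩
          c-uv + c-vu
            ≡⟨ <ᵇ-one-way (u≢v ∘ toℕ-injective) c ⟩
          [ c ]
            ∎
          where open ≡-Reasoning

      nbhdEdges-other : nbhdEdges G' w ≡ nbhdEdges G w + [ A w u ∧ A w v ]
      nbhdEdges-other = begin
        nbhdEdges G' w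
          ≡⟨ nbhdEdges≡sum G' w ⟩
        sum (λ j → sum (isNbhdEdge A' w j))
          ≡⟨ sum-cong-≗ {n} (λ j → trans (sum-cong-≗ {n} (isNbhdEdge-w j)) (∑-distrib-+ {n} _ _)) ⟩
        sum (λ j → sum (isNbhdEdge A w j) + sum (new j))
          ≡⟨ ∑-distrib-+ {n} _ _ ⟩
        sum (λ j → sum (isNbhdEdge A w j)) + sum (λ j → sum (new j))
          ≡⟨ cong₂ _+_ (sym (nbhdEdges≡sum G w)) sum-new ⟩
        nbhdEdges G w + [ c ]
          ∎
        where open ≡-Reasoning

module LocalCoefficients where

  open import Data.Bool using (true; false)
  open import Data.Nat as ℕ using (ℕ; zero; suc; _+_; _*_; _≤_; z≤n; s≤s)
  import Data.Nat.Properties as ℕ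
  open import Data.Nat.Combinatorics using (_C_; nC1≡n; nCk+nC[k+1]≡[n+1]C[k+1])
  open import Data.Nat.Solver using (module +-*-Solver)
  open import Data.Integer using (+_)
  open import Data.Rational as ℚ using (ℚ; _/_)
  import Data.Rational.Properties as ℚ
  open import Function using (_∘_)
  open import Relation.Binary.PropositionalEquality hiding ([_])

  open Fractions
  open +-*-Solver

  -- C(d,2), by recursion so that pairs (2 + k) reduces to a successor and can
  -- serve directly as a denominator.
  pairs : ℕ → ℕ
  pairs zero    = zero
  pairs (suc d) = d + pairs d

  C2≡pairs : ∀ d → d C 2 ≡ pairs d
  C2≡pairs zero          = refl
  C2≡pairs (suc zero)    = refl
  C2≡pairs (suc (suc k)) = trans (sym (nCk+nC[k+1]≡[n+1]C[k+1] (suc k) 1))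
                                 (cong₂ _+_ (nC1≡n (suc k)) (C2≡pairs (suc k)))

  2*pairs : ∀ d → 2 * pairs (suc d) ≡ d * suc d
  2*pairs zero    = refl
  2*pairs (suc d) = begin
    2 * (suc d + pairs (suc d))   ≡⟨ ℕ.*-distribˡ-+ 2 (suc d) _ ⟩
    2 * suc d + 2 * pairs (suc d) ≡⟨ cong (λ x → 2 * suc d + x) (2*pairs d) ⟩
    2 * suc d + d * suc d         ≡⟨ solve 1 (λ d → con 2 :* (con 1 :+ d) :+ d :* (con 1 :+ d) := (con 1 :+ d) :* (con 2 :+ d)) refl d ⟩
    suc d * suc (suc d)           ∎
    where open ≡-Reasoning

  pairs-≤-suc : ∀ d → pairs d ≤ pairs (suc d)
  pairs-≤-suc d = ℕ.m≤n+m (pairs d) d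

  coefficient : ℕ → ℕ → ℚ
  coefficient zero          m = ℚ.0ℚ
  coefficient (suc zero)    m = ℚ.0ℚ
  coefficient (suc (suc k)) m = + m / pairs (suc (suc k))

  localClustering≡coefficient : ∀ {n} (G : Graph n) w → localClustering G w ≡ coefficient (degree G w) (nbhdEdges G w)
  localClustering≡coefficient G w with degree G w
  ... | zero        = refl
  ... | suc zero    = refl
  ... | suc (suc k) = ℚ./-cong {+ nbhdEdges G w} {{C2-nonZero k}} refl (C2≡pairs (suc (suc k)))

  coefficient-zero : ∀ d → coefficient d 0 ≡ ℚ.0ℚ
  coefficient-zero zero          = refl
  coefficient-zero (suc zero)    = refl
  coefficient-zero (suc (suc k)) = ℚ.0/n≡0 (pairs (suc (suc k)))

  -- Increase of C_u when u and v have k common neighbours is at most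
  -- k / C(k+1,2) = 2/(k+1); for k = 0 there is no increase at all.
  endpointGain : ℕ → ℚ
  endpointGain zero    = ℚ.0ℚ
  endpointGain (suc i) = + 2 / suc (suc i)

  coefficient-endpoint-≤ : ∀ d m k → k ≤ d → (d ≤ 1 → m ≡ 0) →
                           coefficient (suc d) (m + k) ℚ.≤ coefficient d m ℚ.+ endpointGain k
  coefficient-endpoint-≤ zero          m zero    _   _  = ℚ.≤-refl
  coefficient-endpoint-≤ (suc zero)    m k       k≤1 m≡0 rewrite m≡0 (s≤s z≤n) with k≤1
  ... | z≤n     = ℚ.≤-refl
  ... | s≤s z≤n = ℚ.≤-refl
  coefficient-endpoint-≤ (suc (suc j)) m zero    _   _
    rewrite ℕ.+-identityʳ m | ℚ.+-identityʳ (coefficient (suc (suc j)) m) =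
    /-mono-≤ {m} {m} {suc j + pairs (suc (suc j))} {j + pairs (suc j)} (ℕ.*-monoʳ-≤ m (pairs-≤-suc (suc (suc j))))
  coefficient-endpoint-≤ (suc (suc j)) m (suc i) k≤d _ =
    ℚ.≤-trans (/-mono-≤ {m + suc i} {m * suc (suc i) + 2 * D} {suc j + pairs (suc (suc j))} {ℕ.pred (D * suc (suc i))} cross)
              (ℚ.≤-reflexive (sym (/-+-/ m 2 (j + pairs (suc j)) (suc i))))
    where
    d D D' : ℕ
    d = suc (suc j)
    D = pairs d
    D' = pairs (suc d)
    -- C(d,2) ≤ C(d+1,2) bounds the old edges, k(k+1) ≤ d(d+1) = 2·C(d+1,2) the new ones.
    cross : (m + suc i) * (D * suc (suc i)) ≤ (m * suc (suc i) + 2 * D) * D'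
    cross = begin
      (m + suc i) * (D * suc (suc i))
        ≡⟨ solve 3 (λ m i D → (m :+ (con 1 :+ i)) :* (D :* (con 2 :+ i))
                           := m :* (con 2 :+ i) :* D :+ (con 1 :+ i) :* (con 2 :+ i) :* D) refl m i D ⟩
      m * suc (suc i) * D + suc i * suc (suc i) * D
        ≤⟨ ℕ.+-mono-≤ (ℕ.*-monoʳ-≤ (m * suc (suc i)) (pairs-≤-suc d))
                      (ℕ.*-monoˡ-≤ D (ℕ.≤-trans (ℕ.*-mono-≤ k≤d (s≤s k≤d)) (ℕ.≤-reflexive (sym (2*pairs d))))) ⟩
      m * suc (suc i) * D' + 2 * D' * D
        ≡⟨ solve 4 (λ m i D D' → m :* (con 2 :+ i) :* D' :+ con 2 :* D' :* D
                              := (m :* (con 2 :+ i) :+ con 2 :* D) :* D') refl m i D D' ⟩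
      (m * suc (suc i) + 2 * D) * D'
        ∎
      where open ℕ.≤-Reasoning

  coefficient-suc-self : ∀ d → coefficient (suc d) d ≡ endpointGain d
  coefficient-suc-self zero    = refl
  coefficient-suc-self (suc r) = /-cong-≡ {suc r} {2} {r + pairs (suc r)} {suc r}
    (sym (2*pairs (suc r)))

  coefficient-+-indicator-≤ : ∀ d m b → coefficient d (m + [ b ]) ℚ.≤ coefficient d m ℚ.+ toℚ [ b ]
  coefficient-+-indicator-≤ d m false rewrite ℕ.+-identityʳ m = ℚ.≤-reflexive (sym (ℚ.+-identityʳ (coefficient d m)))
  coefficient-+-indicator-≤ zero          m true = ℚ.≤ᵇ⇒≤ _
  coefficient-+-indicator-≤ (suc zero)    m true = ℚ.≤ᵇ⇒≤ _
  coefficient-+-indicator-≤ (suc (suc j)) m true = begin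
    + (m + 1) / D              ≡⟨ /-+-same m 1 (j + pairs (suc j)) ⟨
    + m / D ℚ.+ + 1 / D        ≤⟨ ℚ.+-monoʳ-≤ (+ m / D) (/-mono-≤ {1} {1} {j + pairs (suc j)} {0} (s≤s z≤n)) ⟩
    + m / D ℚ.+ toℚ 1          ∎
    where
    open ℚ.≤-Reasoning
    D : ℕ
    D = pairs (suc (suc j))

  coefficient-+1-≡⇒≡2 : ∀ d m → coefficient d (m + 1) ≡ coefficient d m ℚ.+ toℚ 1 → d ≡ 2
  coefficient-+1-≡⇒≡2 zero          m eq with () ← cong ℚ.numerator eq
  coefficient-+1-≡⇒≡2 (suc zero)    m eq with () ← cong ℚ.numerator eq
  coefficient-+1-≡⇒≡2 (suc (suc j)) m eq = cong (suc ∘ suc) (ℕ.m+n≡0⇒m≡0 j j+pairs[1+j]≡0)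
    where
    1/D≡1 : + 1 / pairs (suc (suc j)) ≡ toℚ 1
    1/D≡1 = +-cancelˡ-≡ (+ m / pairs (suc (suc j))) (trans (/-+-same m 1 (j + pairs (suc j))) eq)
    j+pairs[1+j]≡0 : j + pairs (suc j) ≡ 0
    j+pairs[1+j]≡0 = ℕ.suc-injective (trans (sym (ℕ.*-identityˡ _)) (sym (/-injective {1} {1} {j + pairs (suc j)} {0} 1/D≡1)))

  coefficient-2-+1 : ∀ m → coefficient 2 (m + 1) ≡ coefficient 2 m ℚ.+ toℚ 1
  coefficient-2-+1 m = sym (toℚ-+ m 1)

  -- Bound on the increase of Σ_w C_w: endpointGain k at u and at v, and at most 1
  -- at each of the k common neighbours.
  gainBound : ℕ → ℚ
  gainBound k = endpointGain k ℚ.+ endpointGain k ℚ.+ toℚ k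

  gainBound-suc : ∀ i → gainBound (suc i) ≡ + (4 + suc i * suc (suc i)) / suc (suc i)
  gainBound-suc i = begin
    + 2 / suc (suc i) ℚ.+ + 2 / suc (suc i) ℚ.+ toℚ (suc i)
      ≡⟨ cong (ℚ._+ toℚ (suc i)) (/-+-same 2 2 (suc i)) ⟩
    + 4 / suc (suc i) ℚ.+ + (suc i) / 1
      ≡⟨ /-+-/ 4 (suc i) (suc i) 0 ⟩
    + (4 * 1 + suc i * suc (suc i)) / (suc (suc i) * 1)
      ≡⟨ /-cong-≡ {4 * 1 + suc i * suc (suc i)} {4 + suc i * suc (suc i)} {ℕ.pred (suc (suc i) * 1)} {suc i}
           (solve 1 (λ i → (con 4 :* con 1 :+ (con 1 :+ i) :* (con 2 :+ i)) :* (con 2 :+ i)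
                        := (con 4 :+ (con 1 :+ i) :* (con 2 :+ i)) :* ((con 2 :+ i) :* con 1)) refl i) ⟩
    + (4 + suc i * suc (suc i)) / suc (suc i)
      ∎
    where open ≡-Reasoning

  gainBound-<-suc : ∀ k → gainBound k ℚ.< gainBound (suc k)
  gainBound-<-suc zero    = subst (ℚ.0ℚ ℚ.<_) (sym (gainBound-suc 0)) (/-mono-< {0} {6} {0} {1} (s≤s z≤n))
  gainBound-<-suc (suc i) = subst₂ ℚ._<_ (sym (gainBound-suc i)) (sym (gainBound-suc (suc i)))
    (/-mono-< {4 + suc i * suc (suc i)} {4 + suc (suc i) * suc (suc (suc i))} {suc i} {suc (suc i)}
      (ℕ.≤-trans (ℕ.m≤m+n _ (suc (i * i + 5 * i))) (ℕ.≤-reflexive (solve 1 (λ i →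
        (con 1 :+ (con 4 :+ (con 1 :+ i) :* (con 2 :+ i)) :* (con 3 :+ i)) :+ (con 1 :+ (i :* i :+ con 5 :* i))
        := (con 4 :+ (con 2 :+ i) :* (con 3 :+ i)) :* (con 2 :+ i)) refl i))))

  open StrictlyIncreasing gainBound gainBound-<-suc public
    using () renaming (mono-≤ to gainBound-mono-≤; mono-≡⇒≡ to gainBound-injective)

  gainBound-average : ∀ r → gainBound (suc r) ℚ.* (+ 1 / suc (suc (suc r))) ≡ bound (suc (suc (suc r)))
  gainBound-average r = begin
    gainBound (suc r) ℚ.* (+ 1 / n)
      ≡⟨ cong (ℚ._* (+ 1 / n)) (gainBound-suc r) ⟩
    (+ (4 + suc r * suc (suc r)) / suc (suc r)) ℚ.* (+ 1 / n)
      ≡⟨ /-*-/ (4 + suc r * suc (suc r)) 1 (suc r) (suc (suc r)) ⟩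
    + ((4 + suc r * suc (suc r)) * 1) / (suc (suc r) * n)
      ≡⟨ /-cong-≡ {(4 + suc r * suc (suc r)) * 1} {suc r * (n * suc (suc r)) + 4 * n}
                  {ℕ.pred (suc (suc r) * n)} {ℕ.pred (n * (n * suc (suc r)))}
           (solve 1 (λ r → (con 4 :+ (con 1 :+ r) :* (con 2 :+ r)) :* con 1
                             :* ((con 3 :+ r) :* ((con 3 :+ r) :* (con 2 :+ r)))
                        := ((con 1 :+ r) :* ((con 3 :+ r) :* (con 2 :+ r)) :+ con 4 :* (con 3 :+ r))
                             :* ((con 2 :+ r) :* (con 3 :+ r))) refl r) ⟩
    + (suc r * (n * suc (suc r)) + 4 * n) / (n * (n * suc (suc r)))
      ≡⟨ /-+-/ (suc r) 4 (suc (suc r)) (ℕ.pred (n * suc (suc r))) ⟨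
    + suc r / n ℚ.+ + 4 / (n * suc (suc r))
      ≡⟨ cong (ℚ._+ + 4 / (n * suc (suc r))) 1-2/n ⟨
    ℚ.1ℚ ℚ.- + 2 / n ℚ.+ + 4 / (n * suc (suc r))
      ∎
    where
    open ≡-Reasoning
    n : ℕ
    n = suc (suc (suc r))
    1≡[r+1]/n+2/n : ℚ.1ℚ ≡ + suc r / n ℚ.+ + 2 / n
    1≡[r+1]/n+2/n = trans
      (/-cong-≡ {1} {suc r + 2} {0} {suc (suc r)} (solve 1 (λ r → con 1 :* (con 3 :+ r) := (con 1 :+ r :+ con 2) :* con 1) refl r))
      (sym (/-+-same (suc r) 2 (suc (suc r))))
    1-2/n : ℚ.1ℚ ℚ.- + 2 / n ≡ + suc r / n
    1-2/n = begin
      ℚ.1ℚ ℚ.- + 2 / n                     ≡⟨ cong (ℚ._- + 2 / n) 1≡[r+1]/n+2/n ⟩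
      + suc r / n ℚ.+ + 2 / n ℚ.- + 2 / n    ≡⟨ ℚ.+-assoc (+ suc r / n) (+ 2 / n) (ℚ.- (+ 2 / n)) ⟩
      + suc r / n ℚ.+ (+ 2 / n ℚ.- + 2 / n)  ≡⟨ cong (+ suc r / n ℚ.+_) (ℚ.+-inverseʳ (+ 2 / n)) ⟩
      + suc r / n ℚ.+ ℚ.0ℚ                   ≡⟨ ℚ.+-identityʳ (+ suc r / n) ⟩
      + suc r / n                            ∎

module CompleteBipartite where

  open import Data.Bool using (Bool; true; false; _∨_; _xor_)
  open import Data.Bool.Properties using (∨-zeroʳ)
  open import Data.Fin using (Fin; zero; suc; toℕ)
  open import Data.Fin.Patterns using (0F; 1F)
  open import Data.Fin.Permutation as Perm using (_∘ₚ_)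
  import Data.Fin.Permutation.Components as PC
  open import Data.Fin.Properties using (_≟_)
  open import Data.Nat using (suc; _<ᵇ_)
  open import Data.Product using (_,_)
  open import Function using (_∘_; case_of_; Inverse; Injection)
  open import Function.Properties.Inverse using (↔⇒↣)
  open import Relation.Nullary using (does; yes; no; contradiction)
  open import Relation.Nullary.Decidable using (dec-true; dec-false)
  open import Relation.Binary.PropositionalEquality

  open NeighbourhoodEdges using (TriangleFree)

  ≅-triangleFree : ∀ {n} {G H : Graph n} → G ≅ H → TriangleFree H → TriangleFree G
  ≅-triangleFree (π , adj≡) H-triangleFree a b c ab bc =
    trans (adj≡ a c) (H-triangleFree _ _ _ (trans (sym (adj≡ a b)) ab) (trans (sym (adj≡ b c)) bc))

  K2,n-2-triangleFree : ∀ n → TriangleFree (K2,n-2 n)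
  K2,n-2-triangleFree n a b c = xor-triangle (toℕ a <ᵇ 2) (toℕ b <ᵇ 2) (toℕ c <ᵇ 2)
    where
    xor-triangle : ∀ x y z → x xor y ≡ true → y xor z ≡ true → x xor z ≡ false
    xor-triangle false true  false _ _ = refl
    xor-triangle true  false true  _ _ = refl
    xor-triangle false false _     () _
    xor-triangle true  true  _     () _
    xor-triangle false true  true  _ ()
    xor-triangle true  false false _ ()

  module _ {m} {G : Graph (suc (suc m))} {u v : Fin (suc (suc m))} (u≢v : u ≢ v) (u≁v : adj G u v ≡ false)
           (u~rest : ∀ x → x ≢ u → x ≢ v → adj G u x ≡ true)
           (v~rest : ∀ x → x ≢ u → x ≢ v → adj G v x ≡ true)
           (rest-independent : ∀ x y → x ≢ u → x ≢ v → y ≢ u → y ≢ v → adj G x y ≡ false) where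

    private
      inPair : Fin (suc (suc m)) → Bool
      inPair i = does (i ≟ u) ∨ does (i ≟ v)

      adj-inPair : ∀ i j → adj G i j ≡ inPair i xor inPair j
      adj-inPair i j with i ≟ u | i ≟ v | j ≟ u | j ≟ v
      ... | yes refl | yes i≡v | _        | _        = contradiction i≡v u≢v
      ... | _        | _        | yes refl | yes j≡v = contradiction j≡v u≢v
      ... | yes refl | no _     | yes refl | no _    = adj-irrefl G u
      ... | yes refl | no _     | no _     | yes refl = u≁v
      ... | yes refl | no _     | no j≢u   | no j≢v  = u~rest j j≢u j≢v
      ... | no _     | yes refl | yes refl | no _    = trans (adj-sym G v u) u≁v
      ... | no _     | yes refl | no _     | yes refl = adj-irrefl G v
      ... | no _     | yes refl | no j≢u   | no j≢v  = v~rest j j≢u j≢v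
      ... | no i≢u   | no i≢v   | yes refl | no _    = trans (adj-sym G i u) (u~rest i i≢u i≢v)
      ... | no i≢u   | no i≢v   | no _     | yes refl = trans (adj-sym G i v) (v~rest i i≢u i≢v)
      ... | no i≢u   | no i≢v   | no j≢u   | no j≢v  = rest-independent i j i≢u i≢v j≢u j≢v

      -- first move u to 0, then the image of v to 1
      π : Perm.Permutation′ (suc (suc m))
      π = Perm.transpose u 0F ∘ₚ Perm.transpose (PC.transpose u 0F v) 1F

      f : Fin (suc (suc m)) → Fin (suc (suc m))
      f = Inverse.to π

      f-injective : ∀ {x y} → f x ≡ f y → x ≡ y
      f-injective = Injection.injective (↔⇒↣ π)

      transpose-v≢0 : PC.transpose u 0F v ≢ 0F
      transpose-v≢0 rewrite dec-false (v ≟ u) (u≢v ∘ sym) with v ≟ 0F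
      ... | yes refl = u≢v
      ... | no v≢0   = v≢0

      fu≡0 : f u ≡ 0F
      fu≡0 rewrite dec-true (u ≟ u) refl | dec-false (0F ≟ PC.transpose u 0F v) (transpose-v≢0 ∘ sym) = refl

      fv≡1 : f v ≡ 1F
      fv≡1 rewrite dec-true (PC.transpose u 0F v ≟ PC.transpose u 0F v) refl = refl

      inPair-u : inPair u ≡ true
      inPair-u rewrite dec-true (u ≟ u) refl = refl

      inPair-v : inPair v ≡ true
      inPair-v rewrite dec-true (v ≟ v) refl = ∨-zeroʳ _

      side-f : ∀ i → (toℕ (f i) <ᵇ 2) ≡ inPair i
      side-f i with f i in fi≡
      ... | zero        = sym (trans (cong inPair (f-injective {i} {u} (trans fi≡ (sym fu≡0)))) inPair-u)
      ... | suc zero    = sym (trans (cong inPair (f-injective {i} {v} (trans fi≡ (sym fv≡1)))) inPair-v)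
      ... | suc (suc _) rewrite dec-false (i ≟ u) (λ { refl → case trans (sym fi≡) fu≡0 of λ () })
                              | dec-false (i ≟ v) (λ { refl → case trans (sym fi≡) fv≡1 of λ () }) = refl

    ≅K2,n-2 : G ≅ K2,n-2 (suc (suc m))
    ≅K2,n-2 = π , λ i j → trans (adj-inPair i j) (sym (cong₂ _xor_ (side-f i) (side-f j)))

module AddingAnEdge where

  open import Data.Bool using (Bool; true; false; if_then_else_; _∧_; _∨_)
  open import Data.Bool.Properties using (∧-conicalˡ; ∧-conicalʳ)
  open import Data.Fin using (Fin)
  open import Data.Fin.Properties using (_≟_)
  open import Data.Nat as ℕ using (ℕ; suc; _+_; _≤_; _∸_)
  import Data.Nat.Properties as ℕ
  open import Data.Integer using (+_)
  open import Data.Rational as ℚ using (ℚ; _/_)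
  import Data.Rational.Properties as ℚ
  open import Data.Product using (_×_; _,_)
  open import Function using (_∘_; _⇔_; mk⇔; Equivalence)
  open import Relation.Nullary using (Dec; does; yes; no)
  open import Relation.Nullary.Decidable using (dec-true; dec-false)
  open import Relation.Binary.PropositionalEquality hiding ([_])

  open Fractions
  open FiniteSums
  open Counting
  open NeighbourhoodEdges
  open LocalCoefficients
  open CompleteBipartite

  coefficients : ∀ {n} → Graph n → Fin n → ℚ
  coefficients G w = coefficient (degree G w) (nbhdEdges G w)

  coefficientSum : ∀ {n} → Graph n → ℚ
  coefficientSum G = sumℚ (coefficients G)

  clustering≡average : ∀ {m} (G : Graph (suc m)) → clustering G ≡ coefficientSum G ℚ.* (+ 1 / suc m)
  clustering≡average {m} G = cong (ℚ._* (+ 1 / suc m))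
    (trans (Σℚ≡sumℚ (localClustering G)) (sumℚ-cong-≗ (localClustering≡coefficient G)))

  module _ (q : ℚ) .{{_ : ℚ.Positive q}} {x : ℚ} (y z : ℚ) where

    private
      distrib : (y ℚ.+ z) ℚ.* q ≡ y ℚ.* q ℚ.+ z ℚ.* q
      distrib = ℚ.*-distribʳ-+ q y z

    scale-≤ : x ℚ.≤ y ℚ.+ z → x ℚ.* q ℚ.≤ y ℚ.* q ℚ.+ z ℚ.* q
    scale-≤ x≤y+z = ℚ.≤-trans (ℚ.*-monoʳ-≤-nonNeg q {{ℚ.pos⇒nonNeg q}} x≤y+z) (ℚ.≤-reflexive distrib)

    scale-≡⇔ : x ≡ y ℚ.+ z ⇔ x ℚ.* q ≡ y ℚ.* q ℚ.+ z ℚ.* q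
    scale-≡⇔ = mk⇔ (λ eq → trans (cong (ℚ._* q) eq) distrib)
      (λ eq → ℚ.≤-antisym (ℚ.*-cancelʳ-≤-pos q (ℚ.≤-reflexive (trans eq (sym distrib))))
                          (ℚ.*-cancelʳ-≤-pos q (ℚ.≤-reflexive (trans distrib (sym eq)))))

  module Increment {r} (G : Graph (suc (suc (suc r)))) {u v} (u≢v : u ≢ v) (u≁v : adj G u v ≡ false) where

    n : ℕ
    n = suc (suc (suc r))

    G' : Graph n
    G' = addEdge G u v u≢v

    c : ℕ
    c = commonNeighbours G u v

    private
      v≢u : v ≢ u
      v≢u = u≢v ∘ sym

      v≁u : adj G v u ≡ false
      v≁u = trans (adj-sym G v u) u≁v

      module U = AddedEdge G G' u≢v u≁v (λ _ _ → refl)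
      module V = AddedEdge G G' v≢u v≁u (λ i j → cong (adj G i j ∨_) (newEdge-sym u v i j))

      atℚ : Fin n → ℚ → Fin n → ℚ
      atℚ i x w = if does (w ≟ i) then x else ℚ.0ℚ

    common : Fin n → Bool
    common x = adj G u x ∧ adj G v x

    gain : Fin n → ℚ
    gain w = atℚ u (endpointGain c) w ℚ.+ atℚ v (endpointGain c) w ℚ.+ toℚ [ common w ]

    gain-u : gain u ≡ endpointGain c
    gain-u rewrite dec-true (u ≟ u) refl | dec-false (u ≟ v) u≢v | adj-irrefl G u =
      trans (ℚ.+-identityʳ _) (ℚ.+-identityʳ _)

    gain-v : gain v ≡ endpointGain c
    gain-v rewrite dec-false (v ≟ u) v≢u | dec-true (v ≟ v) refl | u≁v =
      trans (ℚ.+-identityʳ _) (ℚ.+-identityˡ _)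

    gain-other : ∀ {w} → w ≢ u → w ≢ v → gain w ≡ toℚ [ adj G w u ∧ adj G w v ]
    gain-other {w} w≢u w≢v rewrite dec-false (w ≟ u) w≢u | dec-false (w ≟ v) w≢v | adj-sym G u w | adj-sym G v w =
      ℚ.+-identityˡ _

    sum-gain : sumℚ gain ≡ gainBound c
    sum-gain = begin
      sumℚ gain
        ≡⟨ ∑ℚ-distrib-+ (λ w → atℚ u (endpointGain c) w ℚ.+ atℚ v (endpointGain c) w) (toℚ ∘ [_] ∘ common) ⟩
      sumℚ (λ w → atℚ u (endpointGain c) w ℚ.+ atℚ v (endpointGain c) w) ℚ.+ sumℚ (toℚ ∘ [_] ∘ common)
        ≡⟨ cong₂ ℚ._+_ (∑ℚ-distrib-+ (atℚ u (endpointGain c)) (atℚ v (endpointGain c))) (sumℚ-toℚ ([_] ∘ common)) ⟩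
      sumℚ (atℚ u (endpointGain c)) ℚ.+ sumℚ (atℚ v (endpointGain c)) ℚ.+ toℚ c
        ≡⟨ cong (ℚ._+ toℚ c) (cong₂ ℚ._+_ (sum-at ℚ.+-0-monoid u (endpointGain c))
                                          (sum-at ℚ.+-0-monoid v (endpointGain c))) ⟩
      gainBound c
        ∎
      where open ≡-Reasoning

    coefficient-u : coefficients G' u ≡ coefficient (suc (degree G u)) (nbhdEdges G u + c)
    coefficient-u = cong₂ coefficient U.degree-endpoint U.nbhdEdges-endpoint

    coefficient-v : coefficients G' v ≡ coefficient (suc (degree G v)) (nbhdEdges G v + c)
    coefficient-v = cong₂ coefficient V.degree-endpoint
      (trans V.nbhdEdges-endpoint (cong (λ x → nbhdEdges G v + x) (commonNeighbours-comm G u v)))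

    coefficient-other : ∀ {w} → w ≢ u → w ≢ v →
                        coefficients G' w ≡ coefficient (degree G w) (nbhdEdges G w + [ adj G w u ∧ adj G w v ])
    coefficient-other w≢u w≢v = cong₂ coefficient (U.degree-other w≢u w≢v) (U.nbhdEdges-other w≢u w≢v)

    private
      endpoint-≤ : ∀ {e} → coefficients G' e ≡ coefficient (suc (degree G e)) (nbhdEdges G e + c) → c ≤ degree G e →
                   gain e ≡ endpointGain c → coefficients G' e ℚ.≤ coefficients G e ℚ.+ gain e
      endpoint-≤ {e} coefficient-e c≤degree gain-e =
        subst₂ ℚ._≤_ (sym coefficient-e) (cong (coefficients G e ℚ.+_) (sym gain-e))
          (coefficient-endpoint-≤ (degree G e) (nbhdEdges G e) c c≤degree (nbhdEdges-degree≤1 G e))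

      local-gain-≤′ : ∀ w → Dec (w ≡ u) → Dec (w ≡ v) → coefficients G' w ℚ.≤ coefficients G w ℚ.+ gain w
      local-gain-≤′ w (yes refl) _ = endpoint-≤ coefficient-u (commonNeighbours-≤-degree G u v) gain-u
      local-gain-≤′ w (no _) (yes refl) = endpoint-≤ coefficient-v
        (subst (_≤ degree G v) (commonNeighbours-comm G u v) (commonNeighbours-≤-degree G v u)) gain-v
      local-gain-≤′ w (no w≢u) (no w≢v) =
        subst₂ ℚ._≤_ (sym (coefficient-other w≢u w≢v)) (cong (coefficients G w ℚ.+_) (sym (gain-other w≢u w≢v)))
          (coefficient-+-indicator-≤ (degree G w) (nbhdEdges G w) (adj G w u ∧ adj G w v))

    local-gain-≤ : ∀ w → coefficients G' w ℚ.≤ coefficients G w ℚ.+ gain w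
    local-gain-≤ w = local-gain-≤′ w (w ≟ u) (w ≟ v)

    private
      common-u : common u ≡ false
      common-u = cong (_∧ adj G v u) (adj-irrefl G u)

      common-v : common v ≡ false
      common-v = cong (_∧ adj G v v) u≁v

      +2≡n⇒ : ∀ {x} → x + 2 ≡ n → x ≡ suc r
      +2≡n⇒ {x} x+2≡n = ℕ.+-cancelʳ-≡ 2 x (suc r) (trans x+2≡n (ℕ.+-comm 2 (suc r)))

      ≡r+1⇒+2≡n : ∀ {x} → x ≡ suc r → x + 2 ≡ n
      ≡r+1⇒+2≡n refl = ℕ.+-comm (suc r) 2

      flip-adj : ∀ {x y} → adj G x y ≡ true → adj G y x ≡ true
      flip-adj {x} {y} = trans (adj-sym G y x)

      q : ℚ
      q = + 1 / n

      instance
        q-positive : ℚ.Positive q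
        q-positive = ℚ.normalize-pos 1 n

    c≤r+1 : c ≤ suc r
    c≤r+1 = ℕ.+-cancelʳ-≤ 2 c (suc r) (subst (c + 2 ≤_) (ℕ.+-comm 2 (suc r)) (count+2≤ u≢v {common} common-u common-v))

    sum-gain-≤ : coefficientSum G' ℚ.≤ coefficientSum G ℚ.+ gainBound c
    sum-gain-≤ = ℚ.≤-trans (sumℚ-mono-≤ local-gain-≤) (ℚ.≤-reflexive
      (trans (∑ℚ-distrib-+ (coefficients G) gain) (cong (coefficientSum G ℚ.+_) sum-gain)))

    sum-≤ : coefficientSum G' ℚ.≤ coefficientSum G ℚ.+ gainBound (suc r)
    sum-≤ = ℚ.≤-trans sum-gain-≤ (ℚ.+-monoʳ-≤ (coefficientSum G) (gainBound-mono-≤ c≤r+1))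

    clustering-≤ : clustering G' ℚ.≤ clustering G ℚ.+ bound n
    clustering-≤ = subst₂ ℚ._≤_ (sym (clustering≡average G'))
      (cong₂ ℚ._+_ (sym (clustering≡average G)) (gainBound-average r))
      (scale-≤ q (coefficientSum G) (gainBound (suc r)) sum-≤)

    clustering-≡⇔sum-≡ : clustering G' ≡ clustering G ℚ.+ bound n ⇔
                          coefficientSum G' ≡ coefficientSum G ℚ.+ gainBound (suc r)
    clustering-≡⇔sum-≡ = mk⇔
      (λ eq → Equivalence.from scaled (trans (sym (clustering≡average G'))
        (trans eq (cong₂ ℚ._+_ (clustering≡average G) (sym (gainBound-average r))))))
      (λ eq → trans (clustering≡average G') (trans (Equivalence.to scaled eq)
        (cong₂ ℚ._+_ (sym (clustering≡average G)) (gainBound-average r))))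
      where
      scaled : coefficientSum G' ≡ coefficientSum G ℚ.+ gainBound (suc r) ⇔
               coefficientSum G' ℚ.* q ≡ coefficientSum G ℚ.* q ℚ.+ gainBound (suc r) ℚ.* q
      scaled = scale-≡⇔ q (coefficientSum G) (gainBound (suc r))

    module Extremal (sum-≡ : coefficientSum G' ≡ coefficientSum G ℚ.+ gainBound (suc r)) where

      c≡r+1 : c ≡ suc r
      c≡r+1 = gainBound-injective c≤r+1 (ℚ.≤-antisym (gainBound-mono-≤ c≤r+1)
        (+-cancelˡ-≤ (coefficientSum G) (subst (ℚ._≤ coefficientSum G ℚ.+ gainBound c) sum-≡ sum-gain-≤)))

      local-gain-≡ : ∀ w → coefficients G' w ≡ coefficients G w ℚ.+ gain w
      local-gain-≡ = sumℚ-mono-≤-tight local-gain-≤ (ℚ.≤-reflexive (begin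
        sumℚ (λ w → coefficients G w ℚ.+ gain w)  ≡⟨ ∑ℚ-distrib-+ (coefficients G) gain ⟩
        coefficientSum G ℚ.+ sumℚ gain            ≡⟨ cong (coefficientSum G ℚ.+_) (trans sum-gain (cong gainBound c≡r+1)) ⟩
        coefficientSum G ℚ.+ gainBound (suc r)    ≡⟨ sum-≡ ⟨
        coefficientSum G'                         ∎))
        where open ≡-Reasoning

      common-rest : ∀ x → x ≢ u → x ≢ v → common x ≡ true
      common-rest = Equivalence.to (count+2≡⇔ u≢v {common} common-u common-v) (≡r+1⇒+2≡n c≡r+1)

      u~rest : ∀ x → x ≢ u → x ≢ v → adj G u x ≡ true
      u~rest x x≢u x≢v = ∧-conicalˡ _ _ (common-rest x x≢u x≢v)

      v~rest : ∀ x → x ≢ u → x ≢ v → adj G v x ≡ true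
      v~rest x x≢u x≢v = ∧-conicalʳ (adj G u x) _ (common-rest x x≢u x≢v)

      private
        rest~u : ∀ x → x ≢ u → x ≢ v → adj G x u ≡ true
        rest~u x x≢u x≢v = flip-adj (u~rest x x≢u x≢v)

        rest~v : ∀ x → x ≢ u → x ≢ v → adj G x v ≡ true
        rest~v x x≢u x≢v = flip-adj (v~rest x x≢u x≢v)

      degree-rest : ∀ w → w ≢ u → w ≢ v → degree G w ≡ 2
      degree-rest w w≢u w≢v = coefficient-+1-≡⇒≡2 (degree G w) (nbhdEdges G w)
        (subst (λ b → coefficient (degree G w) (nbhdEdges G w + [ b ]) ≡ coefficients G w ℚ.+ toℚ [ b ])
               (cong₂ _∧_ (rest~u w w≢u w≢v) (rest~v w w≢u w≢v))
               (trans (sym (coefficient-other w≢u w≢v))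
                      (trans (local-gain-≡ w) (cong (coefficients G w ℚ.+_) (gain-other w≢u w≢v)))))

      rest-independent : ∀ x y → x ≢ u → x ≢ v → y ≢ u → y ≢ v → adj G x y ≡ false
      rest-independent x y x≢u x≢v = Equivalence.to (count≡2⇔ u≢v {adj G x} (rest~u x x≢u x≢v) (rest~v x x≢u x≢v))
        (trans (sym (degree≡count G x)) (degree-rest x x≢u x≢v)) y

      G≅K2,n-2 : G ≅ K2,n-2 n
      G≅K2,n-2 = ≅K2,n-2 {G = G} u≢v u≁v u~rest v~rest rest-independent

      degree-u : degree G u ≡ n ∸ 2
      degree-u = trans (degree≡count G u)
        (+2≡n⇒ (Equivalence.from (count+2≡⇔ u≢v {adj G u} (adj-irrefl G u) u≁v) u~rest))

      degree-v : degree G v ≡ n ∸ 2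
      degree-v = trans (degree≡count G v)
        (+2≡n⇒ (Equivalence.from (count+2≡⇔ u≢v {adj G v} v≁u (adj-irrefl G v)) v~rest))

    module FromK2,n-2 (G≅K2,n-2 : G ≅ K2,n-2 n) (degree-u : degree G u ≡ n ∸ 2) (degree-v : degree G v ≡ n ∸ 2) where

      private
        triangleFree : TriangleFree G
        triangleFree = ≅-triangleFree {G = G} {K2,n-2 n} G≅K2,n-2 (K2,n-2-triangleFree n)

        no-nbhdEdges : ∀ w → nbhdEdges G w ≡ 0
        no-nbhdEdges = nbhdEdges-triangleFree G triangleFree

        u~rest : ∀ x → x ≢ u → x ≢ v → adj G u x ≡ true
        u~rest = Equivalence.to (count+2≡⇔ u≢v {adj G u} (adj-irrefl G u) u≁v)
                   (≡r+1⇒+2≡n (trans (sym (degree≡count G u)) degree-u))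

        v~rest : ∀ x → x ≢ u → x ≢ v → adj G v x ≡ true
        v~rest = Equivalence.to (count+2≡⇔ u≢v {adj G v} v≁u (adj-irrefl G v))
                   (≡r+1⇒+2≡n (trans (sym (degree≡count G v)) degree-v))

        common-rest : ∀ x → x ≢ u → x ≢ v → adj G x u ∧ adj G x v ≡ true
        common-rest x x≢u x≢v = cong₂ _∧_ (flip-adj (u~rest x x≢u x≢v)) (flip-adj (v~rest x x≢u x≢v))

        c≡r+1 : c ≡ suc r
        c≡r+1 = +2≡n⇒ (Equivalence.from (count+2≡⇔ u≢v {common} common-u common-v)
                  (λ x x≢u x≢v → cong₂ _∧_ (u~rest x x≢u x≢v) (v~rest x x≢u x≢v)))

        degree-rest : ∀ w → w ≢ u → w ≢ v → degree G w ≡ 2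
        degree-rest w w≢u w≢v = trans (degree≡count G w)
          (Equivalence.from (count≡2⇔ u≢v {adj G w} (flip-adj (u~rest w w≢u w≢v)) (flip-adj (v~rest w w≢u w≢v)))
            (λ z z≢u z≢v → triangleFree w u z (flip-adj (u~rest w w≢u w≢v)) (u~rest z z≢u z≢v)))

        endpoint-≡ : ∀ {e} → coefficients G' e ≡ coefficient (suc (degree G e)) (nbhdEdges G e + c) →
                     degree G e ≡ suc r → gain e ≡ endpointGain c → coefficients G' e ≡ coefficients G e ℚ.+ gain e
        endpoint-≡ {e} coefficient-e degree-e gain-e = begin
          coefficients G' e
            ≡⟨ coefficient-e ⟩
          coefficient (suc (degree G e)) (nbhdEdges G e + c)
            ≡⟨ cong₂ (coefficient ∘ suc) degree-e (cong₂ _+_ (no-nbhdEdges e) c≡r+1) ⟩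
          coefficient (suc (suc r)) (suc r)
            ≡⟨ coefficient-suc-self (suc r) ⟩
          endpointGain (suc r)
            ≡⟨ ℚ.+-identityˡ _ ⟨
          ℚ.0ℚ ℚ.+ endpointGain (suc r)
            ≡⟨ cong₂ ℚ._+_ C≡0 (trans (cong endpointGain (sym c≡r+1)) (sym gain-e)) ⟩
          coefficients G e ℚ.+ gain e
            ∎
          where
          open ≡-Reasoning
          C≡0 : ℚ.0ℚ ≡ coefficients G e
          C≡0 = sym (trans (cong₂ coefficient degree-e (no-nbhdEdges e)) (coefficient-zero (suc r)))

        rest-≡ : ∀ {w} → w ≢ u → w ≢ v → coefficients G' w ≡ coefficients G w ℚ.+ gain w
        rest-≡ {w} w≢u w≢v = begin
          coefficients G' w
            ≡⟨ coefficient-other w≢u w≢v ⟩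
          coefficient (degree G w) (nbhdEdges G w + [ adj G w u ∧ adj G w v ])
            ≡⟨ cong₂ coefficient degree≡2 (cong₂ _+_ (no-nbhdEdges w) (cong [_] (common-rest w w≢u w≢v))) ⟩
          coefficient 2 (0 + 1)
            ≡⟨ coefficient-2-+1 0 ⟩
          coefficient 2 0 ℚ.+ toℚ 1
            ≡⟨ cong₂ ℚ._+_ (cong₂ coefficient (sym degree≡2) (sym (no-nbhdEdges w)))
                           (trans (cong (toℚ ∘ [_]) (sym (common-rest w w≢u w≢v))) (sym (gain-other w≢u w≢v))) ⟩
          coefficients G w ℚ.+ gain w
            ∎
          where
          open ≡-Reasoning
          degree≡2 : degree G w ≡ 2
          degree≡2 = degree-rest w w≢u w≢v

        local-gain-≡′ : ∀ w → Dec (w ≡ u) → Dec (w ≡ v) → coefficients G' w ≡ coefficients G w ℚ.+ gain w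
        local-gain-≡′ w (yes refl) _          = endpoint-≡ coefficient-u degree-u gain-u
        local-gain-≡′ w (no _)     (yes refl) = endpoint-≡ coefficient-v degree-v gain-v
        local-gain-≡′ w (no w≢u)   (no w≢v)   = rest-≡ w≢u w≢v

      sum-≡ : coefficientSum G' ≡ coefficientSum G ℚ.+ gainBound (suc r)
      sum-≡ = begin
        coefficientSum G'                         ≡⟨ sumℚ-cong-≗ (λ w → local-gain-≡′ w (w ≟ u) (w ≟ v)) ⟩
        sumℚ (λ w → coefficients G w ℚ.+ gain w)  ≡⟨ ∑ℚ-distrib-+ (coefficients G) gain ⟩
        coefficientSum G ℚ.+ sumℚ gain            ≡⟨ cong (coefficientSum G ℚ.+_) (trans sum-gain (cong gainBound c≡r+1)) ⟩
        coefficientSum G ℚ.+ gainBound (suc r)    ∎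
        where open ≡-Reasoning

    clustering-≡⇔K2,n-2 : clustering G' ≡ clustering G ℚ.+ bound n ⇔
                          (G ≅ K2,n-2 n × degree G u ≡ n ∸ 2 × degree G v ≡ n ∸ 2)
    clustering-≡⇔K2,n-2 = mk⇔
      (λ eq → let open Extremal (Equivalence.to clustering-≡⇔sum-≡ eq) in G≅K2,n-2 , degree-u , degree-v)
      (λ (G≅K2,n-2 , degree-u , degree-v) →
         Equivalence.from clustering-≡⇔sum-≡ (FromK2,n-2.sum-≡ G≅K2,n-2 degree-u degree-v))

open import Data.Nat using (ℕ; _≤_; _∸_)
open import Data.Fin using (Fin)
open import Data.Bool using (false)
open import Data.Product using (_×_)
open import Data.Rational using (_+_)
open import Relation.Binary.PropositionalEquality using (_≡_)
open import Relation.Nullary using (¬_)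
open import Function.Bundles using (_⇔_)
open import Data.Rational using () renaming (_≤_ to _≤ℚ_)
open import Data.Nat using (suc; s≤s)
open import Data.Product using (_,_)

open AddingAnEdge using (module Increment)

theorem4 : (n : ℕ) → 3 ≤ n → (G : Graph n) (u v : Fin n) (u≢v : ¬ (u ≡ v)) → adj G u v ≡ false →
    (clustering (addEdge G u v u≢v) ≤ℚ clustering G + bound n)
    × (clustering (addEdge G u v u≢v) ≡ clustering G + bound n
    ⇔ (G ≅ K2,n-2 n × degree G u ≡ n ∸ 2 × degree G v ≡ n ∸ 2))
theorem4 (suc (suc (suc r))) (s≤s (s≤s (s≤s _))) G u v u≢v u≁v =
  clustering-≤ , clustering-≡⇔K2,n-2
  where open Increment G u≢v u≁v
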